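{- Let $G=(V,E)$ be the complete graph and let $L$ be a sequence of moves that is valid from some initial configuration $\tau_0\in[3]^V$. Suppose $C\in\Gamma(L)$ is a leaping cycle over a vertex $v$ that is not tricky. Then there exists a vertex $u\in A(L)\cap S(L[t_{beg}(C),t_{end}(C)])$ such that $vu$ is an $L$-good-arc.
   Context: A configuration is $\tau\in[3]^V$. A move is $(v,p,q)$ with $p\ne q\in[3]$, valid for $\tau$ if $\tau(v)=p$. A sequence $L$ has moves $L(t)=(v_t,p_t,q_t)$; it is valid from $\tau_0$ if each $L(t)$ is valid for $\tau_{t-1}$, where $\tau_t$ is $\tau_{t-1}$ with $v_t$ moved to part $q_t$. For $a\le b$, $L[a,b]$ is the block of moves at time steps $a,\dots,b$, and $S(\cdot)$ denotes the set of vertices moving in a sequence. $M_{L,\tau_0}\in\{0,\pm1\}^{E\times[\ell(L)]}$: $M[\{a,b\},t]=+1$ if ($a=v_t$, $q_t=\tau_t(b)$) or ($b=v_t$, $q_t=\tau_t(a)$); $-1$ if ($a=v_t$, $p_t=\tau_t(b)$) or ($b=v_t$, $p_t=\tau_t(a)$); $0$ otherwise. A $w$-circuit over $v$ is a set of time steps $t_1<\dots<t_w$ with $v_{t_i}=v$, $q_{t_i}=p_{t_{i+1}}$ ($i<w$), $q_{t_w}=p_{t_1}$; a cycle is an inclusion-wise minimal circuit, $T(C)$ its time steps, $t_{beg}(C)=\min T(C)$, $t_{end}(C)=\max T(C)$, $\Gamma(L)$ the set of cycles. $P_{L,\tau_0}[\{a,b\},C]:=\sum_{t\in T(C)}M_{L,\tau_0}[\{a,b\},t]$.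 A vertex is cyclic if some cycle of $L$ is over it, acyclic otherwise; $A(L)$ is the set of acyclic vertices. A cyclic block is a maximal contiguous block of $L$ consisting only of moves of cyclic vertices. A cycle is leaping if its time steps belong to at least two distinct cyclic blocks. A leaping $3$-cycle with time steps $t<t'<t''$ is tricky if $t,t',t''$ lie in three distinct cyclic blocks and $A(L)\cap S(L[t,t'])=A(L)\cap S(L[t',t''])$. For $u,v\in S(L)$, $vu$ is an $L$-good-arc if there is a cycle $C'\in\Gamma(L)$ over $v$ with $P_{L,\tau_0}[\{v,u\},C']\ne0$. -}

module Defs where

open import Data.Nat using (ℕ; suc)
open import Data.Fin using (Fin; toℕ; _≟_) renaming (_≤_ to _≤ᶠ_; _<_ to _<ᶠ_)
open import Data.List using (List; []; _∷_; length; lookup; take; map; foldr)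
open import Data.List.Relation.Unary.All using (All)
open import Data.List.Relation.Unary.Linked using (Linked)
open import Data.List.Membership.Propositional using (_∈_)
open import Data.List.Relation.Binary.Subset.Propositional using (_⊆_)
open import Data.Integer using (ℤ; +_; -[1+_]; _+_)
open import Data.Bool using (Bool; if_then_else_; _∧_; _∨_)
open import Data.Product using (Σ; _×_; ∃; ∃-syntax)
open import Data.Sum using (_⊎_)
open import Data.Empty using (⊥)
open import Relation.Nullary using (¬_; does)
open import Relation.Binary.PropositionalEquality using (_≡_; _≢_)

-- Vertex set V = Fin n; G is the complete graph on V (edges = pairs of distinct vertices).
-- Parts [3] = Fin 3.

Config : ℕ → Set
Config n = Fin n → Fin 3

record Move (n : ℕ) : Set where
  constructor move
  field
    v   : Fin n
    p   : Fin 3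
    q   : Fin 3
    p≢q : p ≢ q
open Move public

update : ∀ {n} → Config n → Fin n → Fin 3 → Config n
update τ x r y = if does (y ≟ x) then r else τ y

applyAll : ∀ {n} → Config n → List (Move n) → Config n
applyAll τ []       = τ
applyAll τ (m ∷ ms) = applyAll (update τ (v m) (q m)) ms

-- Time steps of L: i : Fin (length L) stands for the paper's time step t = toℕ i + 1.
Step : ∀ {n} → List (Move n) → Set
Step L = Fin (length L)

mv : ∀ {n} (L : List (Move n)) → Step L → Move n
mv L i = lookup L i

vtx : ∀ {n} (L : List (Move n)) → Step L → Fin n
vtx L i = v (mv L i)

-- τ_{t-1} and τ_t for time step t = toℕ i + 1
before : ∀ {n} → Config n → (L : List (Move n)) → Step L → Config n
before τ₀ L i = applyAll τ₀ (take (toℕ i) L)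

after : ∀ {n} → Config n → (L : List (Move n)) → Step L → Config n
after τ₀ L i = applyAll τ₀ (take (suc (toℕ i)) L)

Valid : ∀ {n} → Config n → List (Move n) → Set
Valid τ₀ L = ∀ (i : Step L) → before τ₀ L i (vtx L i) ≡ p (mv L i)

-- Entry M_{L,τ₀}[{a,b}, t]  (used for a ≢ b, i.e. edges of the complete graph)
Mentry : ∀ {n} → Config n → (L : List (Move n)) → Fin n → Fin n → Step L → ℤ
Mentry τ₀ L a b i =
  if (does (a ≟ x) ∧ does (qq ≟ τ b)) ∨ (does (b ≟ x) ∧ does (qq ≟ τ a)) then + 1
  else if (does (a ≟ x) ∧ does (pp ≟ τ b)) ∨ (does (b ≟ x) ∧ does (pp ≟ τ a)) then -[1+ 0 ]
  else + 0
  where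
    x  = vtx L i
    pp = p (mv L i)
    qq = q (mv L i)
    τ  = after τ₀ L i

sumℤ : List ℤ → ℤ
sumℤ = foldr _+_ (+ 0)

-- P_{L,τ₀}[{a,b}, C] where C is given by its list of time steps
Pentry : ∀ {n} → Config n → (L : List (Move n)) → Fin n → Fin n → List (Step L) → ℤ
Pentry τ₀ L a b ts = sumℤ (map (Mentry τ₀ L a b) ts)

Chain : ∀ {n} (L : List (Move n)) → (first cur : Step L) → List (Step L) → Set
Chain L first cur []       = q (mv L cur) ≡ p (mv L first)
Chain L first cur (t ∷ ts) = (q (mv L cur) ≡ p (mv L t)) × Chain L first t ts

-- A circuit over x, given as the strictly increasing list t₁ < … < t_w of its time steps (w ≥ 1)
IsCircuit : ∀ {n} (L : List (Move n)) → Fin n → List (Step L) → Set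
IsCircuit L x []       = ⊥
IsCircuit L x (t ∷ ts) =
  Linked _<ᶠ_ (t ∷ ts) × All (λ s → vtx L s ≡ x) (t ∷ ts) × Chain L t t ts

IsCycle : ∀ {n} (L : List (Move n)) → Fin n → List (Step L) → Set
IsCycle {n} L x ts =
  IsCircuit L x ts ×
  (∀ (y : Fin n) (ts' : List (Step L)) → IsCircuit L y ts' → ts' ⊆ ts → ts ⊆ ts')

Cyclic : ∀ {n} → List (Move n) → Fin n → Set
Cyclic L x = ∃[ ts ] IsCycle L x ts

Acyclic : ∀ {n} → List (Move n) → Fin n → Set
Acyclic L x = ¬ Cyclic L x

Between : ∀ {ℓ} → Fin ℓ → Fin ℓ → Fin ℓ → Set
Between i j k = (i ≤ᶠ k × k ≤ᶠ j) ⊎ (j ≤ᶠ k × k ≤ᶠ i)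

SameBlock : ∀ {n} (L : List (Move n)) → Step L → Step L → Set
SameBlock L i j = ∀ k → Between i j k → Cyclic L (vtx L k)

DistinctBlocks : ∀ {n} (L : List (Move n)) → Step L → Step L → Set
DistinctBlocks L i j = Cyclic L (vtx L i) × Cyclic L (vtx L j) × ¬ SameBlock L i j

Leaping : ∀ {n} (L : List (Move n)) → List (Step L) → Set
Leaping L ts = ∃[ i ] ∃[ j ] (i ∈ ts × j ∈ ts × DistinctBlocks L i j)

InS : ∀ {n} (L : List (Move n)) → Step L → Step L → Fin n → Set
InS L a b x = ∃[ k ] (a ≤ᶠ k × k ≤ᶠ b × vtx L k ≡ x)

InSL : ∀ {n} (L : List (Move n)) → Fin n → Set
InSL L x = ∃[ k ] (vtx L k ≡ x)

Tricky : ∀ {n} (L : List (Move n)) → List (Step L) → Set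
Tricky L ts = ∃[ t ] ∃[ t' ] ∃[ t'' ]
  ( ts ≡ t ∷ t' ∷ t'' ∷ []
  × Leaping L ts
  × DistinctBlocks L t t' × DistinctBlocks L t' t'' × DistinctBlocks L t t''
  × (∀ x → Acyclic L x → (InS L t t' x → InS L t' t'' x) × (InS L t' t'' x → InS L t t' x)))

tbeg : ∀ {ℓ} → Fin ℓ → List (Fin ℓ) → Fin ℓ
tbeg t _ = t

tend : ∀ {ℓ} → Fin ℓ → List (Fin ℓ) → Fin ℓ
tend t []        = t
tend _ (t ∷ ts) = tend t ts

-- vu is an L-good-arc ({v,u} ∈ E of the complete graph means u ≢ v)
GoodArc : ∀ {n} → Config n → List (Move n) → Fin n → Fin n → Set
GoodArc τ₀ L x u =
  InSL L x × InSL L u × x ≢ u ×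
  ∃[ ts' ] (IsCycle L x ts' × Pentry τ₀ L x u ts' ≢ + 0)

module Submission where

-- For u ≠ v the weight P[{v,u},C] only depends on the parts of u
-- after the moves of C: a move a → b of v contributes +1 if u is in b, -1 if
-- u is in a, 0 otherwise ('arcSign').  Cycles over three parts have two or
-- three steps, and a finite check over the parts shows that the weight is
-- nonzero as soon as u is in different parts after the first and last move
-- of a 2-cycle, or changes its part between exactly one pair of consecutive
-- moves of a 3-cycle.  An acyclic vertex never returns to a part it left
-- ('Returns' is equivalent to being cyclic), so each of its moves changes
-- its part for good; a vertex that does not move keeps its part ('frame').
-- Leaping cycles contain acyclic moves, and for 3-cycles non-trickiness
-- provides an acyclic vertex moved in only one half of the cycle.

open import Defs
open import Data.Nat using (ℕ)
open import Data.Fin using (Fin)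
open import Data.List using (List; _∷_)
open import Data.Product using (_×_; ∃-syntax)
open import Relation.Nullary using (¬_)

open import Data.Nat as ℕ using (suc; _≤′_; _≤‴_; ≤′-refl; ≤′-step; ≤‴-refl; ≤‴-step; s≤s)
import Data.Nat.Properties as ℕ
open import Data.Fin using (toℕ; fromℕ<; _≟_; _≤_; _<_)
open import Data.Fin.Properties
  using (all?; any?; ¬∀⟶∃¬; toℕ<n; toℕ-fromℕ<; _≤?_; _<?_; ≤-total; ≤∧≢⇒<; <-irrefl; <-trans)
open import Data.List using ([]; length; lookup; take; map)
open import Data.List.Relation.Unary.All as All using (All; []; _∷_)
open import Data.List.Relation.Unary.Any using (here; there)
open import Data.List.Relation.Unary.Linked using (Linked; [-]; _∷_)
open import Data.List.Relation.Unary.Linked.Properties using (Linked⇒All)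
open import Data.List.Membership.Propositional using (_∈_; _∉_)
open import Data.List.Relation.Binary.Subset.Propositional using (_⊆_)
open import Data.Integer as ℤ using (ℤ; +_; -[1+_]; _+_)
open import Data.Bool using (Bool; if_then_else_; _∧_; _∨_)
open import Data.Bool.Properties using (∨-identityʳ)
open import Data.Product using (_,_; proj₁; proj₂)
open import Data.Sum using (_⊎_; inj₁; inj₂)
open import Data.Empty using (⊥; ⊥-elim)
open import Relation.Nullary using (Dec; yes; no; does)
open import Relation.Nullary.Decidable
  using (from-yes; ¬?; _→-dec_; _×-dec_; _⊎-dec_; map′; decidable-stable; dec-true; dec-false)
open import Relation.Binary.PropositionalEquality
  using (_≡_; _≢_; refl; sym; trans; cong; cong₂; cong-app; subst; ≢-sym)

refute-→ : ∀ {A B : Set} → Dec A → ¬ (A → B) → A × ¬ B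
refute-→ (yes a) ¬a→b = a , λ b → ¬a→b (λ _ → b)
refute-→ (no ¬a) ¬a→b = ⊥-elim (¬a→b (λ a → ⊥-elim (¬a a)))

-- The contribution of a move a → b of v to M[{v,u},·] when u is in part c.
arcSign : Fin 3 → Fin 3 → Fin 3 → ℤ
arcSign a b c = if does (b ≟ c) then + 1 else if does (a ≟ c) then -[1+ 0 ] else + 0

thirdPart : (a b c d : Fin 3) → a ≢ b → c ≢ a → c ≢ b → d ≢ a → d ≢ b → c ≡ d
thirdPart = from-yes (all? λ (a : Fin 3) → all? λ (b : Fin 3) → all? λ (c : Fin 3) → all? λ (d : Fin 3) →
  ¬? (a ≟ b) →-dec ¬? (c ≟ a) →-dec ¬? (c ≟ b) →-dec ¬? (d ≟ a) →-dec ¬? (d ≟ b) →-dec c ≟ d)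

-- Since arcSign b a = - arcSign a b and arcSign a b is injective in the part of
-- u, the weight of a 2-cycle a → b → a is arcSign a b c - arcSign a b c'.
-- Checked by evaluation on all parts.
twoCycleCheck : ∀ a b c c' → a ≢ b → c ≢ c' → arcSign a b c + (arcSign b a c' + + 0) ≢ + 0
twoCycleCheck = from-yes (all? λ a → all? λ b → all? λ c → all? λ c' →
  ¬? (a ≟ b) →-dec ¬? (c ≟ c') →-dec ¬? ((arcSign a b c + (arcSign b a c' + + 0)) ℤ.≟ + 0))

-- For a 3-cycle a → b → c → a, arcSign b c d + arcSign c a d = - arcSign a b d,
-- so the weight telescopes when u keeps its part after the last two moves …
threeCycleCheckₗ : ∀ a b c c₁ c₂ → a ≢ b → b ≢ c → c ≢ a → c₁ ≢ c₂ →
  arcSign a b c₁ + (arcSign b c c₂ + (arcSign c a c₂ + + 0)) ≢ + 0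
threeCycleCheckₗ = from-yes (all? λ a → all? λ b → all? λ c → all? λ c₁ → all? λ c₂ →
  ¬? (a ≟ b) →-dec ¬? (b ≟ c) →-dec ¬? (c ≟ a) →-dec ¬? (c₁ ≟ c₂) →-dec
  ¬? ((arcSign a b c₁ + (arcSign b c c₂ + (arcSign c a c₂ + + 0))) ℤ.≟ + 0))

-- … or after the first two moves.
threeCycleCheckᵣ : ∀ a b c c₁ c₂ → a ≢ b → b ≢ c → c ≢ a → c₁ ≢ c₂ →
  arcSign a b c₁ + (arcSign b c c₁ + (arcSign c a c₂ + + 0)) ≢ + 0
threeCycleCheckᵣ = from-yes (all? λ a → all? λ b → all? λ c → all? λ c₁ → all? λ c₂ →
  ¬? (a ≟ b) →-dec ¬? (b ≟ c) →-dec ¬? (c ≟ a) →-dec ¬? (c₁ ≟ c₂) →-dec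
  ¬? ((arcSign a b c₁ + (arcSign b c c₁ + (arcSign c a c₂ + + 0))) ℤ.≟ + 0))

twoCycleWeight : ∀ {a b a' b' c c'} → a ≢ b → b ≡ a' → b' ≡ a → c ≢ c' →
  arcSign a b c + (arcSign a' b' c' + + 0) ≢ + 0
twoCycleWeight a≢b refl refl = twoCycleCheck _ _ _ _ a≢b

ChangesOnce : Fin 3 → Fin 3 → Fin 3 → Set
ChangesOnce c₁ c₂ c₃ = (c₁ ≢ c₂ × c₂ ≡ c₃) ⊎ (c₁ ≡ c₂ × c₂ ≢ c₃)

threeCycleWeight : ∀ {a b a' b' a'' b'' c₁ c₂ c₃} → a ≢ b → a' ≢ b' → a'' ≢ b'' →
  b ≡ a' → b' ≡ a'' → b'' ≡ a → ChangesOnce c₁ c₂ c₃ →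
  arcSign a b c₁ + (arcSign a' b' c₂ + (arcSign a'' b'' c₃ + + 0)) ≢ + 0
threeCycleWeight a≢b b≢c c≢a refl refl refl (inj₁ (c₁≢c₂ , refl)) =
  threeCycleCheckₗ _ _ _ _ _ a≢b b≢c c≢a c₁≢c₂
threeCycleWeight a≢b b≢c c≢a refl refl refl (inj₂ (refl , c₂≢c₃)) =
  threeCycleCheckᵣ _ _ _ _ _ a≢b b≢c c≢a c₂≢c₃

update-self : ∀ {n} (τ : Config n) x r → update τ x r x ≡ r
update-self τ x r rewrite dec-true (x ≟ x) refl = refl

update-other : ∀ {n} (τ : Config n) x r {y} → y ≢ x → update τ x r y ≡ τ y
update-other τ x r {y} y≢x rewrite dec-false (y ≟ x) y≢x = refl

applyAll-take-suc : ∀ {n} (τ : Config n) (ms : List (Move n)) (i : Fin (length ms)) →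
  applyAll τ (take (suc (toℕ i)) ms)
    ≡ update (applyAll τ (take (toℕ i) ms)) (v (lookup ms i)) (q (lookup ms i))
applyAll-take-suc τ (m ∷ ms) Fin.zero    = refl
applyAll-take-suc τ (m ∷ ms) (Fin.suc i) = applyAll-take-suc (update τ (v m) (q m)) ms i

incidence-mover : ∀ {n} (x u : Fin n) (A B C D : Bool) → u ≢ x →
  (if (does (x ≟ x) ∧ A) ∨ (does (u ≟ x) ∧ B) then + 1
   else if (does (x ≟ x) ∧ C) ∨ (does (u ≟ x) ∧ D) then -[1+ 0 ] else + 0)
  ≡ (if A then + 1 else if C then -[1+ 0 ] else + 0)
incidence-mover x u A B C D u≢x
  rewrite dec-true (x ≟ x) refl | dec-false (u ≟ x) u≢x | ∨-identityʳ A | ∨-identityʳ C = refl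

Mentry-mover : ∀ {n} (τ₀ : Config n) (L : List (Move n)) {x u} (i : Step L) →
  vtx L i ≡ x → u ≢ x → Mentry τ₀ L x u i ≡ arcSign (p (mv L i)) (q (mv L i)) (after τ₀ L i u)
Mentry-mover τ₀ L {u = u} i refl u≢x = incidence-mover (vtx L i) u _ _ _ _ u≢x

∉-above : ∀ {m} {c : Fin m} {xs} → All (_< c) xs → c ∉ xs
∉-above xs<c c∈xs = <-irrefl refl (All.lookup xs<c c∈xs)

∉-below : ∀ {m} {c : Fin m} {xs} → All (c <_) xs → c ∉ xs
∉-below c<xs c∈xs = <-irrefl refl (All.lookup c<xs c∈xs)

tend-∈ : ∀ {m} (t : Fin m) ts → tend t ts ∈ t ∷ ts
tend-∈ t []       = here refl
tend-∈ t (s ∷ ts) = there (tend-∈ s ts)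

head-< : ∀ {m} {t : Fin m} {ts e} → Linked _<_ (t ∷ ts) → e ∈ ts → t < e
head-< (t<s ∷ sorted) e∈ = All.lookup (Linked⇒All <-trans t<s sorted) e∈

head-≤ : ∀ {m} {t : Fin m} {ts e} → Linked _<_ (t ∷ ts) → e ∈ t ∷ ts → t ≤ e
head-≤ _      (here refl) = ℕ.≤-refl
head-≤ sorted (there e∈)  = ℕ.<⇒≤ (head-< sorted e∈)

≤-tend : ∀ {m} {t : Fin m} {ts e} → Linked _<_ (t ∷ ts) → e ∈ t ∷ ts → e ≤ tend t ts
≤-tend [-]            (here refl) = ℕ.≤-refl
≤-tend (t<s ∷ sorted) (here refl) = ℕ.<⇒≤ (ℕ.<-≤-trans t<s (≤-tend sorted (here refl)))
≤-tend (_ ∷ sorted)   (there e∈)  = ≤-tend sorted e∈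

module Run {n} (τ₀ : Config n) (L : List (Move n)) (valid : Valid τ₀ L) where

  ℓ : ℕ
  ℓ = length L

  P Q : Step L → Fin 3
  P i = p (mv L i)
  Q i = q (mv L i)

  p≢q-at : (i : Step L) → P i ≢ Q i
  p≢q-at i = p≢q (mv L i)

  starts-differ : ∀ {s s'} → Q s ≡ P s' → P s ≢ P s'
  starts-differ {s} Qs≡Ps' Ps≡Ps' = p≢q-at s (trans Ps≡Ps' (sym Qs≡Ps'))

  -- the configuration after the first j moves: before i = cfg (toℕ i), after i = cfg (suc (toℕ i))
  cfg : ℕ → Config n
  cfg j = applyAll τ₀ (take j L)

  after-self : (i : Step L) → after τ₀ L i (vtx L i) ≡ Q i
  after-self i = trans (cong-app (applyAll-take-suc τ₀ L i) (vtx L i)) (update-self (before τ₀ L i) (vtx L i) (Q i))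

  after-other : (i : Step L) {y : Fin n} → vtx L i ≢ y → after τ₀ L i y ≡ before τ₀ L i y
  after-other i i≢y = trans (cong-app (applyAll-take-suc τ₀ L i) _) (update-other (before τ₀ L i) (vtx L i) (Q i) (≢-sym i≢y))

  at : ∀ {j} → j ℕ.< ℓ → Step L
  at h = fromℕ< h

  cfg-self-at : ∀ {j} (h : j ℕ.< ℓ) → cfg (suc j) (vtx L (at h)) ≡ Q (at h)
  cfg-self-at h = subst (λ m → cfg (suc m) (vtx L (at h)) ≡ Q (at h)) (toℕ-fromℕ< h) (after-self (at h))

  cfg-other-at : ∀ {j y} (h : j ℕ.< ℓ) → vtx L (at h) ≢ y → cfg (suc j) y ≡ cfg j y
  cfg-other-at {y = y} h stays =
    subst (λ m → cfg (suc m) y ≡ cfg m y) (toℕ-fromℕ< h) (after-other (at h) stays)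

  cfg-valid-at : ∀ {j} (h : j ℕ.< ℓ) → cfg j (vtx L (at h)) ≡ P (at h)
  cfg-valid-at h = subst (λ m → cfg m (vtx L (at h)) ≡ P (at h)) (toℕ-fromℕ< h) (valid (at h))

  frame : ∀ {y a b} → a ≤′ b → b ℕ.≤ ℓ →
    (∀ i → a ℕ.≤ toℕ i → toℕ i ℕ.< b → vtx L i ≢ y) → cfg a y ≡ cfg b y
  frame ≤′-refl _ _ = refl
  frame {a = a} {b = suc b} (≤′-step a≤b) b<ℓ stays =
    trans (frame a≤b (ℕ.<⇒≤ b<ℓ) λ i a≤i i<b → stays i a≤i (ℕ.m<n⇒m<1+n i<b))
          (sym (cfg-other-at b<ℓ (stays (at b<ℓ) a≤at at<1+b)))
    where
      a≤at : a ℕ.≤ toℕ (at b<ℓ)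
      a≤at = subst (a ℕ.≤_) (sym (toℕ-fromℕ< b<ℓ)) (ℕ.≤′⇒≤ a≤b)
      at<1+b : toℕ (at b<ℓ) ℕ.< suc b
      at<1+b = ℕ.≤-reflexive (cong suc (toℕ-fromℕ< b<ℓ))

  firstMove : ∀ {y a} (k : Step L) → a ≤‴ toℕ k → vtx L k ≡ y →
    ∃[ k₀ ] (a ℕ.≤ toℕ k₀ × k₀ ≤ k × vtx L k₀ ≡ y × P k₀ ≡ cfg a y)
  firstMove k ≤‴-refl refl = k , ℕ.≤-refl , ℕ.≤-refl , refl , sym (valid k)
  firstMove {y} {a} k (≤‴-step a<k) vk = decide (vtx L (at a<ℓ) ≟ y)
    where
      a<ℓ : a ℕ.< ℓ
      a<ℓ = ℕ.<-trans (ℕ.≤‴⇒≤ a<k) (toℕ<n k)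
      decide : Dec (vtx L (at a<ℓ) ≡ y) → ∃[ k₀ ] (a ℕ.≤ toℕ k₀ × k₀ ≤ k × vtx L k₀ ≡ y × P k₀ ≡ cfg a y)
      decide (yes moves) =
        at a<ℓ , ℕ.≤-reflexive (sym (toℕ-fromℕ< a<ℓ)) ,
        subst (ℕ._≤ toℕ k) (sym (toℕ-fromℕ< a<ℓ)) (ℕ.<⇒≤ (ℕ.≤‴⇒≤ a<k)) , moves ,
        trans (sym (cfg-valid-at a<ℓ)) (cong (cfg a) moves)
      decide (no stays) =
        let (k₀ , a<k₀ , k₀≤k , vk₀ , starts) = firstMove k a<k vk
        in k₀ , ℕ.<⇒≤ a<k₀ , k₀≤k , vk₀ , trans starts (cfg-other-at a<ℓ stays)

  lastMove : ∀ {y b} (k : Step L) → suc (toℕ k) ≤′ b → b ℕ.≤ ℓ → vtx L k ≡ y →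
    ∃[ k₁ ] (k ≤ k₁ × toℕ k₁ ℕ.< b × vtx L k₁ ≡ y × Q k₁ ≡ cfg b y)
  lastMove k ≤′-refl _ refl = k , ℕ.≤-refl , ℕ.≤-refl , refl , sym (after-self k)
  lastMove {y} {suc b} k (≤′-step k<b) b<ℓ vk = decide (vtx L (at b<ℓ) ≟ y)
    where
      decide : Dec (vtx L (at b<ℓ) ≡ y) → ∃[ k₁ ] (k ≤ k₁ × toℕ k₁ ℕ.< suc b × vtx L k₁ ≡ y × Q k₁ ≡ cfg (suc b) y)
      decide (yes moves) =
        at b<ℓ , subst (toℕ k ℕ.≤_) (sym (toℕ-fromℕ< b<ℓ)) (ℕ.<⇒≤ (ℕ.≤′⇒≤ k<b)) ,
        ℕ.≤-reflexive (cong suc (toℕ-fromℕ< b<ℓ)) , moves ,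
        trans (sym (cfg-self-at b<ℓ)) (cong (cfg (suc b)) moves)
      decide (no stays) =
        let (k₁ , k≤k₁ , k₁<b , vk₁ , ends) = lastMove k k<b (ℕ.<⇒≤ b<ℓ) vk
        in k₁ , k≤k₁ , ℕ.m<n⇒m<1+n k₁<b , vk₁ , trans ends (sym (cfg-other-at b<ℓ stays))

  Returns : Fin n → Set
  Returns y = ∃[ k ] ∃[ k' ] (k < k' × vtx L k ≡ y × vtx L k' ≡ y × P k ≡ Q k')

  returns? : ∀ y → Dec (Returns y)
  returns? y = any? λ k → any? λ k' →
    (k <? k') ×-dec (vtx L k ≟ y) ×-dec (vtx L k' ≟ y) ×-dec (P k ≟ Q k')

  -- A vertex moving during [a, b) with the same part at times a and b returns:
  -- its first move there starts where its last move ends.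
  returns-of-repeat : ∀ {y a b} (k : Step L) → vtx L k ≡ y → a ℕ.≤ toℕ k → toℕ k ℕ.< b → b ℕ.≤ ℓ →
    cfg a y ≡ cfg b y → Returns y
  returns-of-repeat k vk a≤k k<b b≤ℓ same =
    let (k₀ , _ , k₀≤k , vk₀ , starts) = firstMove k (ℕ.≤⇒≤‴ a≤k) vk
        (k₁ , k≤k₁ , _ , vk₁ , ends) = lastMove k (ℕ.≤⇒≤′ k<b) b≤ℓ vk
        back = trans starts (trans same (sym ends))
    in k₀ , k₁ , ≤∧≢⇒< (ℕ.≤-trans k₀≤k k≤k₁) (λ k₀≡k₁ → p≢q-at k₀ (trans back (cong Q (sym k₀≡k₁)))) , vk₀ , vk₁ , back

  chain-successor : ∀ {first} cur ts {e} → Chain L first cur ts → e ∈ cur ∷ ts →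
    ∃[ e' ] ((e' ≡ first ⊎ e' ∈ ts) × P e' ≡ Q e)
  chain-successor cur []       closes   (here refl) = _ , inj₁ refl , sym closes
  chain-successor cur (s ∷ ts) (c , _)  (here refl) = s , inj₂ (here refl) , sym c
  chain-successor cur (s ∷ ts) (_ , ch) (there e∈) with chain-successor s ts ch e∈
  ... | e' , inj₁ e'≡first , starts = e' , inj₁ e'≡first , starts
  ... | e' , inj₂ e'∈ , starts      = e' , inj₂ (there e'∈) , starts

  circuit-successor : ∀ {y ts e} → IsCircuit L y ts → e ∈ ts → ∃[ e' ] (e' ∈ ts × P e' ≡ Q e)
  circuit-successor {ts = t ∷ ts} (_ , _ , ch) e∈ with chain-successor t ts ch e∈
  ... | e' , inj₁ refl , starts = e' , here refl , starts
  ... | e' , inj₂ e'∈ , starts  = e' , there e'∈ , starts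

  -- Two chained moves a → b → a form a cycle: a sub-circuit containing one of
  -- them must contain its successor, which can only be the other one.
  twoCycle : ∀ {y s₁ s₂} → s₁ < s₂ → vtx L s₁ ≡ y → vtx L s₂ ≡ y →
    Q s₁ ≡ P s₂ → Q s₂ ≡ P s₁ → IsCycle L y (s₁ ∷ s₂ ∷ [])
  twoCycle {y} {s₁} {s₂} s₁<s₂ v₁ v₂ c₁ c₂ = (s₁<s₂ ∷ [-] , v₁ ∷ v₂ ∷ [] , c₁ , c₂) , minimal
    where
      minimal : ∀ y' ts → IsCircuit L y' ts → ts ⊆ s₁ ∷ s₂ ∷ [] → s₁ ∷ s₂ ∷ [] ⊆ ts
      minimal y' (e ∷ ts) circ sub = covers (sub (here refl))
        where
          from₁ : s₁ ∈ e ∷ ts → s₂ ∈ e ∷ ts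
          from₁ m with circuit-successor circ m
          ... | e' , e'∈ , starts with sub e'∈
          ...   | here refl         = ⊥-elim (p≢q-at s₁ starts)
          ...   | there (here refl) = e'∈
          from₂ : s₂ ∈ e ∷ ts → s₁ ∈ e ∷ ts
          from₂ m with circuit-successor circ m
          ... | e' , e'∈ , starts with sub e'∈
          ...   | here refl         = e'∈
          ...   | there (here refl) = ⊥-elim (p≢q-at s₂ starts)
          covers : e ∈ s₁ ∷ s₂ ∷ [] → s₁ ∷ s₂ ∷ [] ⊆ e ∷ ts
          covers (here refl)         (here refl)         = here refl
          covers (here refl)         (there (here refl)) = from₁ (here refl)
          covers (there (here refl)) (here refl)         = from₂ (here refl)
          covers (there (here refl)) (there (here refl)) = here refl

  threeCycle : ∀ {y s₁ s₂ s₃} → s₁ < s₂ → s₂ < s₃ → vtx L s₁ ≡ y → vtx L s₂ ≡ y → vtx L s₃ ≡ y →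
    Q s₁ ≡ P s₂ → Q s₂ ≡ P s₃ → Q s₃ ≡ P s₁ → IsCycle L y (s₁ ∷ s₂ ∷ s₃ ∷ [])
  threeCycle {y} {s₁} {s₂} {s₃} s₁<s₂ s₂<s₃ v₁ v₂ v₃ c₁ c₂ c₃ =
    (s₁<s₂ ∷ s₂<s₃ ∷ [-] , v₁ ∷ v₂ ∷ v₃ ∷ [] , c₁ , c₂ , c₃) , minimal
    where
      minimal : ∀ y' ts → IsCircuit L y' ts → ts ⊆ s₁ ∷ s₂ ∷ s₃ ∷ [] → s₁ ∷ s₂ ∷ s₃ ∷ [] ⊆ ts
      minimal y' (e ∷ ts) circ sub = covers (sub (here refl))
        where
          from₁ : s₁ ∈ e ∷ ts → s₂ ∈ e ∷ ts
          from₁ m with circuit-successor circ m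
          ... | e' , e'∈ , starts with sub e'∈
          ...   | here refl                 = ⊥-elim (p≢q-at s₁ starts)
          ...   | there (here refl)         = e'∈
          ...   | there (there (here refl)) = ⊥-elim (p≢q-at s₂ (trans (sym c₁) (trans (sym starts) (sym c₂))))
          from₂ : s₂ ∈ e ∷ ts → s₃ ∈ e ∷ ts
          from₂ m with circuit-successor circ m
          ... | e' , e'∈ , starts with sub e'∈
          ...   | here refl                 = ⊥-elim (p≢q-at s₃ (trans (sym c₂) (trans (sym starts) (sym c₃))))
          ...   | there (here refl)         = ⊥-elim (p≢q-at s₂ starts)
          ...   | there (there (here refl)) = e'∈
          from₃ : s₃ ∈ e ∷ ts → s₁ ∈ e ∷ ts
          from₃ m with circuit-successor circ m
          ... | e' , e'∈ , starts with sub e'∈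
          ...   | here refl                 = e'∈
          ...   | there (here refl)         = ⊥-elim (p≢q-at s₁ (trans (sym c₃) (trans (sym starts) (sym c₁))))
          ...   | there (there (here refl)) = ⊥-elim (p≢q-at s₃ starts)
          covers : e ∈ s₁ ∷ s₂ ∷ s₃ ∷ [] → s₁ ∷ s₂ ∷ s₃ ∷ [] ⊆ e ∷ ts
          covers e∈ (here refl)                 = from-any e∈
            where
              from-any : e ∈ s₁ ∷ s₂ ∷ s₃ ∷ [] → s₁ ∈ e ∷ ts
              from-any (here refl)                 = here refl
              from-any (there (here refl))         = from₃ (from₂ (here refl))
              from-any (there (there (here refl))) = from₃ (here refl)
          covers e∈ (there (here refl))         = from₁ (covers e∈ (here refl))
          covers e∈ (there (there (here refl))) = from₂ (from₁ (covers e∈ (here refl)))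

  noLoop : ∀ {y t} → ¬ IsCircuit L y (t ∷ [])
  noLoop {t = t} (_ , _ , closes) = p≢q-at t (sym closes)

  chain-end : ∀ {first} cur ts → Chain L first cur ts → Q (tend cur ts) ≡ P first
  chain-end cur []       closes  = closes
  chain-end cur (s ∷ ts) (_ , ch) = chain-end s ts ch

  returns-of-cyclic : ∀ {y} → Cyclic L y → Returns y
  returns-of-cyclic (t ∷ [] , circ , _) = ⊥-elim (noLoop circ)
  returns-of-cyclic (t ∷ s ∷ ss , (sorted , moves , _ , ch) , _) =
    t , tend s ss , head-< sorted (tend-∈ s ss) ,
    All.lookup moves (here refl) , All.lookup moves (there (tend-∈ s ss)) , sym (chain-end s ss ch)

  -- A returning vertex is cyclic: either the return closes a 2-cycle, or the
  -- next move after k leads, through the third part, to a 2- or 3-cycle.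
  cyclic-of-returns : ∀ {y} → Returns y → Cyclic L y
  cyclic-of-returns (k , k' , k<k' , refl , vk' , back)
    with P k' ≟ Q k | firstMove k' (ℕ.≤⇒≤‴ k<k') vk'
  ... | yes direct | _ = _ , twoCycle k<k' refl vk' (sym direct) (sym back)
  ... | no detour | m , k<m , m≤k' , vm , starts with Q m ≟ P k
  ...   | yes closes = _ , twoCycle k<m refl vm (sym (trans starts (after-self k))) closes
  ...   | no ¬closes = _ , threeCycle k<m m<k' refl vm vk' Qk≡Pm Qm≡Pk' (sym back)
    where
      Qk≡Pm : Q k ≡ P m
      Qk≡Pm = sym (trans starts (after-self k))
      m<k' : m < k'
      m<k' = ≤∧≢⇒< m≤k' (λ { refl → detour (sym Qk≡Pm) })
      Qm≡Pk' : Q m ≡ P k'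
      Qm≡Pk' = thirdPart (P k) (Q k) (Q m) (P k') (p≢q-at k) ¬closes
                 (λ Qm≡Qk → p≢q-at m (trans (sym Qk≡Pm) (sym Qm≡Qk)))
                 (λ Pk'≡Pk → p≢q-at k' (trans Pk'≡Pk back)) detour

  cyclic? : ∀ y → Dec (Cyclic L y)
  cyclic? y = map′ cyclic-of-returns returns-of-cyclic (returns? y)

  -- An acyclic vertex never returns, so each of its moves changes its part for good.
  acyclic-moves : ∀ {y a b} → Acyclic L y → (k : Step L) → vtx L k ≡ y →
    a ℕ.≤ toℕ k → toℕ k ℕ.< b → b ℕ.≤ ℓ → cfg a y ≢ cfg b y
  acyclic-moves acyc k vk a≤k k<b b≤ℓ same = acyc (cyclic-of-returns (returns-of-repeat k vk a≤k k<b b≤ℓ same))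

  separated : ∀ {s k s'} → Cyclic L (vtx L s) → Acyclic L (vtx L k) → s ≤ k → k ≤ s' →
    after τ₀ L s (vtx L k) ≢ after τ₀ L s' (vtx L k)
  separated {s} {k} cyc acyc s≤k k≤s' = acyclic-moves acyc _ refl s<k (s≤s k≤s') (toℕ<n _)
    where
      s<k : s < k
      s<k = ≤∧≢⇒< s≤k (λ { refl → acyc cyc })

  unmoved : ∀ {y s s'} → s ≤ s' → ¬ InS L s s' y → after τ₀ L s y ≡ after τ₀ L s' y
  unmoved s≤s' notIn = frame (ℕ.≤⇒≤′ (s≤s s≤s')) (toℕ<n _)
    λ i s<i i<1+s' vi → notIn (i , ℕ.<⇒≤ s<i , ℕ.≤-pred i<1+s' , vi)

  no-proper-subcircuit : ∀ {y y' C C' e} → IsCycle L y C → IsCircuit L y' C' → C' ⊆ C →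
    e ∈ C → e ∉ C' → ⊥
  no-proper-subcircuit (_ , minimal) circ sub e∈ e∉ = e∉ (minimal _ _ circ sub e∈)

  -- A cycle has at most three steps: otherwise its first steps contain a shorter sub-circuit.
  atMostThree : ∀ {y s₁ s₂ s₃ s₄ rest} → ¬ IsCycle L y (s₁ ∷ s₂ ∷ s₃ ∷ s₄ ∷ rest)
  atMostThree cyc@((s₁<s₂ ∷ s₂<s₃ ∷ s₃<s₄ ∷ _ , v₁ ∷ v₂ ∷ v₃ ∷ _ , c₁ , c₂ , c₃ , _) , _)
    with P _ ≟ P _ | P _ ≟ P _ | <-trans s₁<s₂ s₂<s₃ | <-trans s₂<s₃ s₃<s₄
  ... | yes P₃≡P₁ | _ | s₁<s₃ | _ =
    no-proper-subcircuit cyc (proj₁ (twoCycle s₁<s₂ v₁ v₂ c₁ (trans c₂ P₃≡P₁)))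
      (λ { (here refl) → here refl ; (there (here refl)) → there (here refl) })
      (there (there (here refl))) (∉-above (s₁<s₃ ∷ s₂<s₃ ∷ []))
  ... | no _ | yes P₄≡P₂ | s₁<s₃ | _ =
    no-proper-subcircuit cyc (proj₁ (twoCycle s₂<s₃ v₂ v₃ c₂ (trans c₃ P₄≡P₂)))
      (λ { (here refl) → there (here refl) ; (there (here refl)) → there (there (here refl)) })
      (here refl) (∉-below (s₁<s₂ ∷ s₁<s₃ ∷ []))
  ... | no P₃≢P₁ | no P₄≢P₂ | _ | s₂<s₄ =
    no-proper-subcircuit cyc (proj₁ (threeCycle s₁<s₂ s₂<s₃ v₁ v₂ v₃ c₁ c₂ (trans c₃ P₄≡P₁)))
      (λ { (here refl) → here refl ; (there (here refl)) → there (here refl)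
         ; (there (there (here refl))) → there (there (here refl)) })
      (there (there (there (here refl)))) (∉-above (<-trans s₁<s₂ s₂<s₄ ∷ s₂<s₄ ∷ s₃<s₄ ∷ []))
    where
      P₄≡P₁ : P _ ≡ P _
      P₄≡P₁ = thirdPart _ _ _ _ (starts-differ c₂) P₄≢P₂
                (λ P₄≡P₃ → starts-differ c₃ (sym P₄≡P₃)) (starts-differ c₁)
                (λ P₁≡P₃ → P₃≢P₁ (sym P₁≡P₃))

  cyclic-at : ∀ {x t ts s} → IsCycle L x (t ∷ ts) → s ∈ t ∷ ts → Cyclic L (vtx L s)
  cyclic-at cyc@((_ , moves , _) , _) s∈ = subst (Cyclic L) (sym (All.lookup moves s∈)) (_ , cyc)

  not-same-block : ∀ {s s' y} → Acyclic L y → InS L s s' y → ¬ SameBlock L s s'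
  not-same-block acyc (k , s≤k , k≤s' , refl) same = acyc (same k (inj₁ (s≤k , k≤s')))

  acyclic-between : ∀ {i j} → ¬ SameBlock L i j → ∃[ k ] (Between i j k × Acyclic L (vtx L k))
  acyclic-between {i} {j} notSame =
    let (k , ¬same) = ¬∀⟶∃¬ ℓ _ (λ k → between? k →-dec cyclic? (vtx L k)) notSame
    in k , refute-→ (between? k) ¬same
    where
      between? : ∀ k → Dec (Between i j k)
      between? k = ((i ≤? k) ×-dec (k ≤? j)) ⊎-dec ((j ≤? k) ×-dec (k ≤? i))

  leaping-gap : ∀ {y t ts} → IsCircuit L y (t ∷ ts) → Leaping L (t ∷ ts) →
    ∃[ k ] (t ≤ k × k ≤ tend t ts × Acyclic L (vtx L k))
  leaping-gap (sorted , _) (i , j , i∈ , j∈ , _ , _ , notSame) with acyclic-between notSame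
  ... | k , inj₁ (i≤k , k≤j) , acyc =
    k , ℕ.≤-trans (head-≤ sorted i∈) i≤k , ℕ.≤-trans k≤j (≤-tend sorted j∈) , acyc
  ... | k , inj₂ (j≤k , k≤i) , acyc =
    k , ℕ.≤-trans (head-≤ sorted j∈) j≤k , ℕ.≤-trans k≤i (≤-tend sorted i∈) , acyc

  HasAcyclicGoodArc : Fin n → Step L → List (Step L) → Set
  HasAcyclicGoodArc x t ts = ∃[ u ] (Acyclic L u × InS L (tbeg t ts) (tend t ts) u × GoodArc τ₀ L x u)

  ArcWeight : Fin n → List (Step L) → ℤ
  ArcWeight u ts = sumℤ (map (λ s → arcSign (P s) (Q s) (after τ₀ L s u)) ts)

  Pentry-mover : ∀ {x u} ts → All (λ s → vtx L s ≡ x) ts → u ≢ x → Pentry τ₀ L x u ts ≡ ArcWeight u ts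
  Pentry-mover []       []          _   = refl
  Pentry-mover (s ∷ ts) (vs ∷ vts) u≢x = cong₂ _+_ (Mentry-mover τ₀ L s vs u≢x) (Pentry-mover ts vts u≢x)

  goodArc-at : ∀ {x t ts} → IsCycle L x (t ∷ ts) → (k : Step L) → t ≤ k → k ≤ tend t ts →
    Acyclic L (vtx L k) → ArcWeight (vtx L k) (t ∷ ts) ≢ + 0 → HasAcyclicGoodArc x t ts
  goodArc-at {x} {t} {ts} cyc@((_ , moves@(vt ∷ _) , _) , _) k t≤k k≤e acyc weight =
    vtx L k , acyc , (k , t≤k , k≤e , refl) , (t , vt) , (k , refl) , x≢u ,
    (t ∷ ts , cyc , λ P≡0 → weight (trans (sym (Pentry-mover (t ∷ ts) moves (≢-sym x≢u))) P≡0))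
    where
      x≢u : x ≢ vtx L k
      x≢u x≡u = acyc (subst (Cyclic L) x≡u (_ , cyc))

  -- Leaping 2-cycles: the acyclic move between the two steps changes u's part.
  twoCycle-arc : ∀ {x t t₂} → IsCycle L x (t ∷ t₂ ∷ []) → Leaping L (t ∷ t₂ ∷ []) →
    HasAcyclicGoodArc x t (t₂ ∷ [])
  twoCycle-arc cyc@(circ@(_ , _ , back , forth) , _) leap =
    let (k , t≤k , k≤t₂ , acyc) = leaping-gap circ leap
    in goodArc-at cyc k t≤k k≤t₂ acyc
         (twoCycleWeight (p≢q-at _) back forth (separated (cyclic-at cyc (here refl)) acyc t≤k k≤t₂))

  inS? : ∀ s s' y → Dec (InS L s s' y)
  inS? s s' y = any? λ k → (s ≤? k) ×-dec (k ≤? s') ×-dec (vtx L k ≟ y)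

  OnlyIn : Step L → Step L → Step L → Step L → Set
  OnlyIn s₁ s₂ s₃ s₄ = ∃[ k ] (s₁ ≤ k × k ≤ s₂ × Acyclic L (vtx L k) × ¬ InS L s₃ s₄ (vtx L k))

  onlyIn? : ∀ s₁ s₂ s₃ s₄ → Dec (OnlyIn s₁ s₂ s₃ s₄)
  onlyIn? s₁ s₂ s₃ s₄ = any? λ k →
    (s₁ ≤? k) ×-dec (k ≤? s₂) ×-dec ¬? (cyclic? (vtx L k)) ×-dec ¬? (inS? s₃ s₄ (vtx L k))

  moves-also : ∀ {s₁ s₂ s₃ s₄ y} → ¬ OnlyIn s₁ s₂ s₃ s₄ → Acyclic L y → InS L s₁ s₂ y → InS L s₃ s₄ y
  moves-also {s₃ = s₃} {s₄} none acyc (k , s₁≤k , k≤s₂ , refl) =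
    decidable-stable (inS? s₃ s₄ (vtx L k)) (λ notIn → none (k , s₁≤k , k≤s₂ , acyc , notIn))

  -- A leaping 3-cycle that is not tricky has an acyclic vertex moved in only one
  -- of its halves; otherwise both halves move the same acyclic vertices and the
  -- acyclic move between its ends separates all three blocks.
  untricky : ∀ {x t t' t''} → IsCycle L x (t ∷ t' ∷ t'' ∷ []) → Leaping L (t ∷ t' ∷ t'' ∷ []) →
    ¬ Tricky L (t ∷ t' ∷ t'' ∷ []) → OnlyIn t t' t' t'' ⊎ OnlyIn t' t'' t t'
  untricky {t = t} {t'} {t''} cyc leap notTricky
    with onlyIn? t t' t' t'' | onlyIn? t' t'' t t' | leaping-gap (proj₁ cyc) leap
  ... | yes first | _          | _ = inj₁ first
  ... | no _      | yes second | _ = inj₂ second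
  ... | no none₁  | no none₂   | k , t≤k , k≤t'' , acyc =
    ⊥-elim (notTricky (t , t' , t'' , refl , leap ,
      (cyc-t , cyc-t' , not-same-block acyc (proj₁ inBoth)) ,
      (cyc-t' , cyc-t'' , not-same-block acyc (proj₂ inBoth)) ,
      (cyc-t , cyc-t'' , not-same-block acyc (k , t≤k , k≤t'' , refl)) ,
      λ y acyc-y → moves-also none₁ acyc-y , moves-also none₂ acyc-y))
    where
      cyc-t : Cyclic L (vtx L t)
      cyc-t = cyclic-at cyc (here refl)
      cyc-t' : Cyclic L (vtx L t')
      cyc-t' = cyclic-at cyc (there (here refl))
      cyc-t'' : Cyclic L (vtx L t'')
      cyc-t'' = cyclic-at cyc (there (there (here refl)))
      inBoth : InS L t t' (vtx L k) × InS L t' t'' (vtx L k)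
      inBoth with ≤-total k t'
      ... | inj₁ k≤t' = let first = (k , t≤k , k≤t' , refl) in first , moves-also none₁ acyc first
      ... | inj₂ t'≤k = let second = (k , t'≤k , k≤t'' , refl) in moves-also none₂ acyc second , second

  threeCycle-arc-at : ∀ {x t t' t''} → IsCycle L x (t ∷ t' ∷ t'' ∷ []) → (k : Step L) → t ≤ k → k ≤ t'' →
    Acyclic L (vtx L k) →
    ChangesOnce (after τ₀ L t (vtx L k)) (after τ₀ L t' (vtx L k)) (after τ₀ L t'' (vtx L k)) →
    HasAcyclicGoodArc x t (t' ∷ t'' ∷ [])
  threeCycle-arc-at cyc@((_ , _ , c₁ , c₂ , c₃) , _) k t≤k k≤t'' acyc once =
    goodArc-at cyc k t≤k k≤t'' acyc (threeCycleWeight (p≢q-at _) (p≢q-at _) (p≢q-at _) c₁ c₂ c₃ once)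

  -- Leaping non-tricky 3-cycles: the vertex moved in one half only changes its
  -- part exactly once during the cycle.
  threeCycle-arc : ∀ {x t t' t''} → IsCycle L x (t ∷ t' ∷ t'' ∷ []) → Leaping L (t ∷ t' ∷ t'' ∷ []) →
    ¬ Tricky L (t ∷ t' ∷ t'' ∷ []) → HasAcyclicGoodArc x t (t' ∷ t'' ∷ [])
  threeCycle-arc cyc@((t<t' ∷ t'<t'' ∷ [-] , _) , _) leap notTricky with untricky cyc leap notTricky
  ... | inj₁ (k , t≤k , k≤t' , acyc , notIn) =
    threeCycle-arc-at cyc k t≤k (ℕ.≤-trans k≤t' (ℕ.<⇒≤ t'<t'')) acyc
      (inj₁ (separated (cyclic-at cyc (here refl)) acyc t≤k k≤t' , unmoved (ℕ.<⇒≤ t'<t'') notIn))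
  ... | inj₂ (k , t'≤k , k≤t'' , acyc , notIn) =
    threeCycle-arc-at cyc k (ℕ.≤-trans (ℕ.<⇒≤ t<t') t'≤k) k≤t'' acyc
      (inj₂ (unmoved (ℕ.<⇒≤ t<t') notIn , separated (cyclic-at cyc (there (here refl))) acyc t'≤k k≤t''))

lemma4p18 : (n : ℕ) (τ₀ : Config n) (L : List (Move n)) → Valid τ₀ L →
    (x : Fin n) (t : Step L) (ts : List (Step L)) →
    IsCycle L x (t ∷ ts) → Leaping L (t ∷ ts) → ¬ Tricky L (t ∷ ts) →
    ∃[ u ] (Acyclic L u × InS L (tbeg t ts) (tend t ts) u × GoodArc τ₀ L x u)
lemma4p18 n τ₀ L valid x t []                  cyc _    _         = ⊥-elim (Run.noLoop τ₀ L valid (proj₁ cyc))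
lemma4p18 n τ₀ L valid x t (_ ∷ [])            cyc leap _         = Run.twoCycle-arc τ₀ L valid cyc leap
lemma4p18 n τ₀ L valid x t (_ ∷ _ ∷ [])        cyc leap notTricky = Run.threeCycle-arc τ₀ L valid cyc leap notTricky
lemma4p18 n τ₀ L valid x t (_ ∷ _ ∷ _ ∷ _)     cyc _    _         = ⊥-elim (Run.atMostThree τ₀ L valid cyc)
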